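{- Let $Q=T[H_1,\dots,H_t]$ be a semicomplete composition such that $T$ has no sink. Then $Q$ contains a pair of disjoint quasi-kernels. In particular, every strong semicomplete composition contains a pair of disjoint quasi-kernels.
   Context: All digraphs are finite, without loops or parallel arcs; $d_D(x,y)$ is the length of a shortest directed $x$–$y$ path. Let $T$ be a digraph with vertices $u_1,\dots,u_t$ ($t\ge 2$) and $H_1,\dots,H_t$ digraphs, $H_i$ having vertices $u_{i,j}$, $1\le j\le n_i$. The composition $Q=T[H_1,\dots,H_t]$ has vertex set $\{u_{i,j}\}$ and arc set $\bigcup_i A(H_i)\cup\{u_{i,j}u_{p,q}: u_iu_p\in A(T)\}$ (all $j,q$). It is a semicomplete composition if $T$ is semicomplete (at least one arc between every two distinct vertices). A sink is a vertex of out-degree $0$. A digraph is strong if every vertex can reach every other vertex. A quasi-kernel of a digraph $D$ is an independent set $K\subseteq V(D)$ (no arcs between vertices of $K$) such that for every $x\in V(D)\setminus K$ there is $y\in K$ with $d_D(x,y)\le 2$. -}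

module Defs where

open import Data.Nat using (ℕ; zero; suc; _≤_)
open import Data.Fin using (Fin; _≟_)
open import Data.Bool using (Bool; true; false)
open import Data.Empty using (⊥)
open import Data.Sum using (_⊎_)
open import Data.Product using (Σ; Σ-syntax; _×_; _,_)
open import Relation.Binary.PropositionalEquality using (_≡_; refl)
open import Relation.Nullary using (¬_; yes; no)

record Digraph : Set where
  field
    size     : ℕ
    arc      : Fin size → Fin size → Bool
    loopless : ∀ x → arc x x ≡ false
open Digraph public

data Walk {V : Set} (A : V → V → Bool) : ℕ → V → V → Set where
  here : ∀ {x} → Walk A zero x x
  step : ∀ {k x y z} → A x y ≡ true → Walk A k y z → Walk A (suc k) x z

DistLe : {V : Set} → (V → V → Bool) → V → V → ℕ → Set
DistLe A x y k = Σ[ m ∈ ℕ ] (m ≤ k × Walk A m x y)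

Strong : {V : Set} → (V → V → Bool) → Set
Strong {V} A = ∀ (x y : V) → Σ[ m ∈ ℕ ] Walk A m x y

-- vertex subsets are Boolean predicates on V
Independent : {V : Set} → (V → V → Bool) → (V → Bool) → Set
Independent A K = ∀ x y → K x ≡ true → K y ≡ true → A x y ≡ false

QuasiKernel : {V : Set} → (V → V → Bool) → (V → Bool) → Set
QuasiKernel {V} A K =
  Independent A K ×
  (∀ (x : V) → K x ≡ false → Σ[ y ∈ V ] (K y ≡ true × DistLe A x y 2))

Disjoint : {V : Set} → (V → Bool) → (V → Bool) → Set
Disjoint K₁ K₂ = ∀ x → K₁ x ≡ true → K₂ x ≡ true → ⊥

HasDisjointQKPair : {V : Set} → (V → V → Bool) → Set
HasDisjointQKPair {V} A =
  Σ[ K₁ ∈ (V → Bool) ] Σ[ K₂ ∈ (V → Bool) ]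
    (QuasiKernel A K₁ × QuasiKernel A K₂ × Disjoint K₁ K₂)

Semicomplete : Digraph → Set
Semicomplete T = ∀ (i j : Fin (size T)) → ¬ (i ≡ j) →
  (arc T i j ≡ true) ⊎ (arc T j i ≡ true)

NoSink : Digraph → Set
NoSink T = ∀ (i : Fin (size T)) → Σ[ j ∈ Fin (size T) ] (arc T i j ≡ true)

-- Composition Q = T[H₁,…,H_t]; vertex u_{i,j} is the pair (i , j).

CompVertex : (T : Digraph) → (Fin (size T) → Digraph) → Set
CompVertex T H = Σ[ i ∈ Fin (size T) ] Fin (size (H i))

compArc : (T : Digraph) (H : Fin (size T) → Digraph) →
          CompVertex T H → CompVertex T H → Bool
compArc T H (i , j) (p , q) with i ≟ p
... | yes refl = arc (H i) j q
... | no _     = arc T i p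

module Submission where

-- Call a vertex j of a digraph a king if every vertex reaches j by
-- a directed walk of length at most 2.  If i is a king of T and K is a
-- quasi-kernel of the block H_i, then the copy of K inside block i is a
-- quasi-kernel of Q = T[H₁,…,H_t]: vertices of block i reach it inside
-- H_i, and a vertex of another block p follows a short p–i walk of T,
-- which lifts to Q because every block is nonempty.  Two distinct kings
-- of T therefore give two disjoint quasi-kernels of Q.

open import Defs
open import Data.Nat using (ℕ; zero; suc; _≥_; _≤_; NonZero; z≤n; s≤s)
open import Data.Nat.Properties using (≤-trans; ≤-refl)
open import Data.Product using (_×_; Σ-syntax; _,_; proj₁; proj₂)
open import Data.Fin using (Fin; zero; suc) renaming (_≟_ to _≟F_)
open import Data.Fin.Properties using (any?)
open import Data.Bool using (Bool; true; false)
open import Data.Bool.Properties using (¬-not) renaming (_≟_ to _≟B_)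
open import Data.Sum using (_⊎_; inj₁; inj₂)
open import Data.Empty using (⊥; ⊥-elim)
open import Data.List using (List; []; _∷_; length; filter; allFin)
open import Data.List.Properties using (length-filter)
open import Data.List.Membership.Propositional using (_∈_)
open import Data.List.Membership.Propositional.Properties
  using (∈-filter⁻; ∈-filter⁺; ∈-allFin)
open import Data.List.Relation.Unary.Any using (here; there)
open import Relation.Binary.PropositionalEquality using (_≡_; refl; sym; trans; subst)
open import Relation.Nullary using (¬_; yes; no)
open import Relation.Nullary.Decidable using (¬?; _×-dec_)
open import Relation.Unary using (Decidable)

true-and-false : ∀ {b} → b ≡ true → b ≡ false → ⊥
true-and-false refl ()

not-true : ∀ {b} → ¬ b ≡ true → b ≡ false
not-true = ¬-not

module _ {V : Set} (A : V → V → Bool) where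

  dist-0 : ∀ {x} → DistLe A x x 2
  dist-0 = 0 , z≤n , here

  dist-1 : ∀ {x y} → A x y ≡ true → DistLe A x y 2
  dist-1 xy = 1 , s≤s z≤n , step xy here

  dist-2 : ∀ {x y z} → A x y ≡ true → A y z ≡ true → DistLe A x z 2
  dist-2 xy yz = 2 , ≤-refl , step xy (step yz here)

King : {V : Set} → (V → V → Bool) → V → Set
King A j = ∀ v → DistLe A v j 2

-- 1. Existence of quasi-kernels (Chvátal–Lovász)

module QuasiKernels {m : ℕ} (A : Fin m → Fin m → Bool)
                    (loopless-A : ∀ x → A x x ≡ false) where

  -- K is a quasi-kernel of the vertex list L: K ⊆ L is independent and
  -- every vertex of L is within distance 2 (in the whole digraph) of K.
  QuasiKernelOn : List (Fin m) → (Fin m → Bool) → Set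
  QuasiKernelOn L K =
    (∀ x → K x ≡ true → x ∈ L) × Independent A K ×
    (∀ x → x ∈ L → K x ≡ false → Σ[ y ∈ Fin m ] (K y ≡ true × DistLe A x y 2))

  -- y is neither x nor an in-neighbour of x; the recursion removes x
  -- and its in-neighbours, which can all reach x in one step.
  Remote : Fin m → Fin m → Set
  Remote x y = ¬ y ≡ x × A y x ≡ false

  remote? : ∀ x → Decidable (Remote x)
  remote? x y = ¬? (y ≟F x) ×-dec (A y x ≟B false)

  remoteFrom : Fin m → List (Fin m) → List (Fin m)
  remoteFrom x = filter (remote? x)

  remote-≢ : ∀ {x z xs} → z ∈ remoteFrom x xs → ¬ z ≡ x
  remote-≢ {x} {xs = xs} z∈ = proj₁ (proj₂ (∈-filter⁻ (remote? x) {xs = xs} z∈))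

  insert : Fin m → (Fin m → Bool) → Fin m → Bool
  insert x K z with z ≟F x
  ... | yes _ = true
  ... | no _  = K z

  insert-new : ∀ x K → insert x K x ≡ true
  insert-new x K with x ≟F x
  ... | yes _ = refl
  ... | no x≢x = ⊥-elim (x≢x refl)

  insert-old : ∀ x K z → K z ≡ true → insert x K z ≡ true
  insert-old x K z Kz with z ≟F x
  ... | yes _ = refl
  ... | no _  = Kz

  insert-other : ∀ x K z → ¬ z ≡ x → insert x K z ≡ K z
  insert-other x K z z≢x with z ≟F x
  ... | yes z≡x = ⊥-elim (z≢x z≡x)
  ... | no _    = refl

  insert-cases : ∀ x K z → insert x K z ≡ true → z ≡ x ⊎ K z ≡ true
  insert-cases x K z with z ≟F x
  ... | yes z≡x = λ _ → inj₁ z≡x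
  ... | no _    = inj₂

  near-or-remote : ∀ x xs z → z ∈ (x ∷ xs) →
                   z ≡ x ⊎ A z x ≡ true ⊎ z ∈ remoteFrom x xs
  near-or-remote x xs z z∈ with z ≟F x | A z x ≟B true
  ... | yes z≡x | _      = inj₁ z≡x
  ... | no _    | yes zx = inj₂ (inj₁ zx)
  ... | no z≢x  | no ¬zx with z∈
  ...   | here z≡x = ⊥-elim (z≢x z≡x)
  ...   | there z∈xs = inj₂ (inj₂ (∈-filter⁺ (remote? x) z∈xs (z≢x , not-true ¬zx)))

  -- Induction step: a quasi-kernel K of the vertices remote from x extends
  -- to x ∷ xs, either unchanged (if x → y for some y ∈ K) or by adding x.
  extend : ∀ x xs → Σ[ K ∈ (Fin m → Bool) ] QuasiKernelOn (remoteFrom x xs) K →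
           Σ[ K ∈ (Fin m → Bool) ] QuasiKernelOn (x ∷ xs) K
  extend x xs (K , K⊆ , indK , covK)
    with any? (λ y → (K y ≟B true) ×-dec (A x y ≟B true))
  ... | yes (y , Ky , xy) = K , K⊆′ , indK , cov
    where
    K⊆′ : ∀ z → K z ≡ true → z ∈ (x ∷ xs)
    K⊆′ z Kz = there (proj₁ (∈-filter⁻ (remote? x) (K⊆ z Kz)))
    cov : ∀ z → z ∈ (x ∷ xs) → K z ≡ false →
          Σ[ y ∈ Fin m ] (K y ≡ true × DistLe A z y 2)
    cov z z∈ Kz with near-or-remote x xs z z∈
    ... | inj₁ refl        = y , Ky , dist-1 A xy
    ... | inj₂ (inj₁ zx)   = y , Ky , dist-2 A zx xy
    ... | inj₂ (inj₂ z∈′)  = covK z z∈′ Kz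
  ... | no no-out = K′ , K′⊆ , ind , cov
    where
    K′ = insert x K
    remote-of : ∀ z → K z ≡ true → Remote x z
    remote-of z Kz = proj₂ (∈-filter⁻ (remote? x) {xs = xs} (K⊆ z Kz))
    K′⊆ : ∀ z → K′ z ≡ true → z ∈ (x ∷ xs)
    K′⊆ z K′z with insert-cases x K z K′z
    ... | inj₁ refl = here refl
    ... | inj₂ Kz   = there (proj₁ (∈-filter⁻ (remote? x) (K⊆ z Kz)))
    ind : Independent A K′
    ind a b K′a K′b with insert-cases x K a K′a | insert-cases x K b K′b
    ... | inj₁ refl | inj₁ refl = loopless-A a
    ... | inj₁ refl | inj₂ Kb   = not-true (λ ab → no-out (b , Kb , ab))
    ... | inj₂ Ka   | inj₁ refl = proj₂ (remote-of a Ka)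
    ... | inj₂ Ka   | inj₂ Kb   = indK a b Ka Kb
    cov : ∀ z → z ∈ (x ∷ xs) → K′ z ≡ false →
          Σ[ y ∈ Fin m ] (K′ y ≡ true × DistLe A z y 2)
    cov z z∈ K′z with near-or-remote x xs z z∈
    ... | inj₁ refl       = ⊥-elim (true-and-false (insert-new x K) K′z)
    ... | inj₂ (inj₁ zx)  = x , insert-new x K , dist-1 A zx
    ... | inj₂ (inj₂ z∈′) with covK z z∈′ (trans (sym (insert-other x K z (remote-≢ {xs = xs} z∈′))) K′z)
    ...   | y , Ky , d = y , insert-old x K y Ky , d

  quasiKernelOn : ∀ L → Σ[ K ∈ (Fin m → Bool) ] QuasiKernelOn L K
  quasiKernelOn L = bounded (length L) L ≤-refl
    where
    bounded : ∀ n L → length L ≤ n → Σ[ K ∈ (Fin m → Bool) ] QuasiKernelOn L K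
    bounded _ [] _ = (λ _ → false) , (λ _ ()) , (λ _ _ ()) , (λ _ ())
    bounded (suc n) (x ∷ xs) (s≤s |xs|≤n) =
      extend x xs (bounded n (remoteFrom x xs)
                     (≤-trans (length-filter (remote? x) xs) |xs|≤n))

  quasiKernel : Σ[ K ∈ (Fin m → Bool) ] QuasiKernel A K
  quasiKernel with quasiKernelOn (allFin m)
  ... | K , _ , ind , cov = K , ind , λ x Kx → cov x (∈-allFin x) Kx

  quasiKernelOn-nonempty : ∀ {L} K → QuasiKernelOn L K → ∀ v → v ∈ L →
                           Σ[ r ∈ Fin m ] K r ≡ true
  quasiKernelOn-nonempty K (_ , _ , cov) v v∈ with K v ≟B true
  ... | yes Kv = v , Kv
  ... | no ¬Kv with cov v v∈ (not-true ¬Kv)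
  ...   | r , Kr , _ = r , Kr

  quasiKernel-nonempty : ∀ K → QuasiKernel A K → Fin m → Σ[ r ∈ Fin m ] K r ≡ true
  quasiKernel-nonempty K (ind , cov) v =
    quasiKernelOn-nonempty K ((λ x _ → ∈-allFin x) , ind , λ x _ → cov x) v (∈-allFin v)

-- 2. Kings of semicomplete digraphs

module Kings (T : Digraph) (semicomplete : Semicomplete T) where

  open QuasiKernels (arc T) (loopless T)
    using (QuasiKernelOn; quasiKernelOn; quasiKernelOn-nonempty)

  independent-unique : (K : Fin (size T) → Bool) → Independent (arc T) K →
                       ∀ a b → K a ≡ true → K b ≡ true → a ≡ b
  independent-unique K ind a b Ka Kb with a ≟F b
  ... | yes a≡b = a≡b
  ... | no a≢b with semicomplete a b a≢b
  ...   | inj₁ ab = ⊥-elim (true-and-false ab (ind a b Ka Kb))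
  ...   | inj₂ ba = ⊥-elim (true-and-false ba (ind b a Kb Ka))

  -- Every nonempty list L contains a vertex j within distance 2 of every
  -- vertex of L: the unique element of a quasi-kernel of L.
  kingOf : (L : List (Fin (size T))) → ∀ s → s ∈ L →
           Σ[ j ∈ Fin (size T) ] (j ∈ L × (∀ v → v ∈ L → DistLe (arc T) v j 2))
  kingOf L s s∈ with quasiKernelOn L
  ... | K , qk@(K⊆ , ind , cov) with quasiKernelOn-nonempty K qk s s∈
  ...   | j , Kj = j , K⊆ j Kj , reach
    where
    reach : ∀ v → v ∈ L → DistLe (arc T) v j 2
    reach v v∈ with K v ≟B true
    ... | yes Kv = subst (λ w → DistLe (arc T) v w 2)
                         (independent-unique K ind v j Kv Kj) (dist-0 (arc T))
    ... | no ¬Kv with cov v v∈ (not-true ¬Kv)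
    ...   | y , Ky , d = subst (λ w → DistLe (arc T) v w 2)
                               (independent-unique K ind y j Ky Kj) d

  outNeighbours : Fin (size T) → List (Fin (size T))
  outNeighbours i = filter (λ v → arc T i v ≟B true) (allFin _)

  -- Without sinks there are two kings: a king i of T, and a king j of the
  -- out-neighbourhood of i, which also absorbs i (i → j) and every
  -- in-neighbour v of i (v → i → j).
  twoKings : NoSink T → Fin (size T) →
             Σ[ i ∈ Fin (size T) ] Σ[ j ∈ Fin (size T) ]
               (¬ i ≡ j × King (arc T) i × King (arc T) j)
  twoKings noSink s with kingOf (allFin _) s (∈-allFin s)
  ... | i , _ , reach-i with noSink i
  ...   | o , io with kingOf (outNeighbours i) o (∈-filter⁺ _ (∈-allFin o) io)
  ...     | j , j∈ , reach-j = i , j , i≢j , (λ v → reach-i v (∈-allFin v)) , king-j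
    where
    ij : arc T i j ≡ true
    ij = proj₂ (∈-filter⁻ (λ v → arc T i v ≟B true) {xs = allFin _} j∈)
    i≢j : ¬ i ≡ j
    i≢j refl = true-and-false ij (loopless T i)
    king-j : King (arc T) j
    king-j v with v ≟F i
    ... | yes refl = dist-1 (arc T) ij
    ... | no v≢i with semicomplete v i v≢i
    ...   | inj₁ vi = dist-2 (arc T) vi ij
    ...   | inj₂ iv = reach-j v (∈-filter⁺ _ (∈-allFin v) iv)

-- 3. Quasi-kernels of the composition

someVertex : ∀ n → NonZero n → Fin n
someVertex (suc n) _ = zero

module Composition (T : Digraph) (H : Fin (size T) → Digraph)
                   (nonempty : ∀ i → NonZero (size (H i))) where

  V = CompVertex T H
  Q = compArc T H

  arc-inside : ∀ i j q → Q (i , j) (i , q) ≡ arc (H i) j q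
  arc-inside i j q with i ≟F i
  ... | yes refl = refl
  ... | no i≢i = ⊥-elim (i≢i refl)

  arc-between : ∀ {i p} j q → ¬ i ≡ p → Q (i , j) (p , q) ≡ arc T i p
  arc-between {i} {p} j q i≢p with i ≟F p
  ... | yes i≡p = ⊥-elim (i≢p i≡p)
  ... | no _    = refl

  arc-distinct : ∀ {a b} → arc T a b ≡ true → ¬ a ≡ b
  arc-distinct {a} ab refl = true-and-false ab (loopless T a)

  lift-inside : ∀ {i k j q} → Walk (arc (H i)) k j q → Walk Q k (i , j) (i , q)
  lift-inside here = here
  lift-inside {i} (step e w) = step (trans (arc-inside i _ _) e) (lift-inside w)

  lift-between : ∀ {k a b} → Walk (arc T) (suc k) a b → ∀ q r →
                 Walk Q (suc k) (a , q) (b , r)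
  lift-between (step ab here) q r = step (trans (arc-between q r (arc-distinct ab)) ab) here
  lift-between (step {y = c} ac (step e w)) q r =
    step (trans (arc-between q (someVertex _ (nonempty c)) (arc-distinct ac)) ac)
         (lift-between (step e w) _ r)

  inBlock : (i : Fin (size T)) → (Fin (size (H i)) → Bool) → V → Bool
  inBlock i K (p , q) with p ≟F i
  ... | yes refl = K q
  ... | no _     = false

  inBlock-self : ∀ i K q → inBlock i K (i , q) ≡ K q
  inBlock-self i K q with i ≟F i
  ... | yes refl = refl
  ... | no i≢i = ⊥-elim (i≢i refl)

  inBlock-members : ∀ i K v → inBlock i K v ≡ true →
                    Σ[ q ∈ Fin (size (H i)) ] (v ≡ (i , q) × K q ≡ true)
  inBlock-members i K (p , q) with p ≟F i
  ... | yes refl = λ Kq → q , refl , Kq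
  ... | no _     = λ ()

  liftQuasiKernel : ∀ i → King (arc T) i → (K : Fin (size (H i)) → Bool) →
                    QuasiKernel (arc (H i)) K → Σ[ r ∈ Fin (size (H i)) ] K r ≡ true →
                    QuasiKernel Q (inBlock i K)
  liftQuasiKernel i king K (indK , covK) (r , Kr) = ind , cov
    where
    ind : Independent Q (inBlock i K)
    ind a b Ka Kb with inBlock-members i K a Ka | inBlock-members i K b Kb
    ... | q₁ , refl , Kq₁ | q₂ , refl , Kq₂ =
      trans (arc-inside i q₁ q₂) (indK q₁ q₂ Kq₁ Kq₂)
    cov : ∀ x → inBlock i K x ≡ false →
          Σ[ y ∈ V ] (inBlock i K y ≡ true × DistLe Q x y 2)
    cov (p , q) Kx with p ≟F i
    ... | yes refl with covK q Kx
    ...   | y , Ky , (k , k≤2 , w) =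
      (i , y) , trans (inBlock-self i K y) Ky , (k , k≤2 , lift-inside w)
    cov (p , q) Kx | no p≢i with king p
    ...   | zero , _ , here = ⊥-elim (p≢i refl)
    ...   | suc k , k≤2 , w =
      (i , r) , trans (inBlock-self i K r) Kr , (suc k , k≤2 , lift-between w q r)

  blockQuasiKernel : ∀ i → King (arc T) i →
                     Σ[ K ∈ (V → Bool) ] (QuasiKernel Q K × (∀ v → K v ≡ true → proj₁ v ≡ i))
  blockQuasiKernel i king with QuasiKernels.quasiKernel (arc (H i)) (loopless (H i))
  ... | K , qk = inBlock i K , liftQuasiKernel i king K qk nonemptyK , inside
    where
    nonemptyK : Σ[ r ∈ Fin (size (H i)) ] K r ≡ true
    nonemptyK = QuasiKernels.quasiKernel-nonempty (arc (H i)) (loopless (H i))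
                  K qk (someVertex _ (nonempty i))
    inside : ∀ v → inBlock i K v ≡ true → proj₁ v ≡ i
    inside v Kv with inBlock-members i K v Kv
    ... | _ , refl , _ = refl

  disjointPair : ∀ i j → ¬ i ≡ j → King (arc T) i → King (arc T) j → HasDisjointQKPair Q
  disjointPair i j i≢j king-i king-j
    with blockQuasiKernel i king-i | blockQuasiKernel j king-j
  ... | K₁ , qk₁ , in-i | K₂ , qk₂ , in-j =
    K₁ , K₂ , qk₁ , qk₂ , λ v K₁v K₂v → i≢j (trans (sym (in-i v K₁v)) (in-j v K₂v))

  leaves-block : ∀ {k x v} → Walk Q k x v → ¬ proj₁ v ≡ proj₁ x →
                 Σ[ j ∈ Fin (size T) ] arc T (proj₁ x) j ≡ true
  leaves-block here v≢x = ⊥-elim (v≢x refl)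
  leaves-block {x = a , b} (step {y = c , d} e w) v≢x with c ≟F a
  ... | yes refl = leaves-block w v≢x
  ... | no c≢a = c , trans (sym (arc-between b d (λ a≡c → c≢a (sym a≡c)))) e

  anotherVertex : ∀ {n} → 2 ≤ n → (i : Fin n) → Σ[ p ∈ Fin n ] ¬ p ≡ i
  anotherVertex (s≤s (s≤s _)) zero    = suc zero , λ ()
  anotherVertex (s≤s (s≤s _)) (suc i) = zero , λ ()

  -- If Q is strong and T has two vertices, every block has an exit, so T
  -- has no sink.
  strong⇒noSink : size T ≥ 2 → Strong Q → NoSink T
  strong⇒noSink t≥2 strong i with anotherVertex t≥2 i
  ... | p , p≢i with strong (i , someVertex _ (nonempty i)) (p , someVertex _ (nonempty p))
  ...   | _ , w = leaves-block w p≢i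

firstVertex : ∀ {n} → 2 ≤ n → Fin n
firstVertex (s≤s (s≤s _)) = zero

theorem3p3 :
    ((T : Digraph) (H : Fin (size T) → Digraph) →
      size T ≥ 2 → (∀ i → NonZero (size (H i))) →
      Semicomplete T → NoSink T →
      HasDisjointQKPair (compArc T H))
    ×
    ((T : Digraph) (H : Fin (size T) → Digraph) →
      size T ≥ 2 → (∀ i → NonZero (size (H i))) →
      Semicomplete T → Strong (compArc T H) →
      HasDisjointQKPair (compArc T H))
theorem3p3 = noSinkCase , strongCase
  where
  noSinkCase : (T : Digraph) (H : Fin (size T) → Digraph) →
    size T ≥ 2 → (∀ i → NonZero (size (H i))) →
    Semicomplete T → NoSink T → HasDisjointQKPair (compArc T H)
  noSinkCase T H t≥2 nonempty sc noSink
    with Kings.twoKings T sc noSink (firstVertex t≥2)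
  ... | i , j , i≢j , king-i , king-j =
    Composition.disjointPair T H nonempty i j i≢j king-i king-j

  strongCase : (T : Digraph) (H : Fin (size T) → Digraph) →
    size T ≥ 2 → (∀ i → NonZero (size (H i))) →
    Semicomplete T → Strong (compArc T H) → HasDisjointQKPair (compArc T H)
  strongCase T H t≥2 nonempty sc strong =
    noSinkCase T H t≥2 nonempty sc (Composition.strong⇒noSink T H nonempty t≥2 strong)
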